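{- For any $m \geq 1$ and $n = 2^k - 1$, where $k \in \mathbb{N}$, \[ \mathrm{qc}(m, n) \leq n \left( \log_2 \frac{m+n}{n + 1} + 3 \right) - \log_2 (n + 1). \]
   Context: Search game on the grid $S_1\times\cdots\times S_d$ with $S_i=\{0,\ldots,n_i-1\}$: Adversary fixes a target $t$; Algorithm queries a point $q$; if $q\neq t$, Adversary answers for every coordinate $i$ one of $t_i<q_i$ or $t_i>q_i$, at least one of these $d$ inequalities being true, and Algorithm does not learn which one. $\mathrm{qc}(n_1,\ldots,n_d)$ denotes the minimum number of queries that guarantees finding the target (the query complexity). Here $d=2$; no order relation between $m$ and $n$ is assumed. -}

module Defs where

open import Data.Nat using (ℕ; zero; suc; _<ᵇ_; _≡ᵇ_)
open import Data.Fin using (Fin; toℕ)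
open import Data.Bool using (Bool; true; false; _∧_; _∨_; not)
open import Data.Product using (Σ)
open import Relation.Binary.PropositionalEquality using (_≡_)

-- The answer given by the Adversary for one coordinate i:
--   below  means  "t_i < q_i",   above  means  "t_i > q_i".
data Dir : Set where
  below above : Dir

holds : Dir → ℕ → ℕ → Bool
holds below t q = t <ᵇ q
holds above t q = q <ᵇ t

-- Knowledge state of Algorithm: the set of targets (points of
-- S_1 × S_2 = Fin m × Fin n) still consistent with all answers so far.
Cand : ℕ → ℕ → Set
Cand m n = Fin m → Fin n → Bool

-- Target (x , y) is consistent with the answer (a , b) to the query (qx , qy):
-- the target differs from the query (otherwise the game would have ended) and
-- at least one of the two announced inequalities is true for it.
consistent : {m n : ℕ} → Fin m → Fin n → Dir → Dir → Fin m → Fin n → Bool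
consistent qx qy a b x y =
  not ((toℕ x ≡ᵇ toℕ qx) ∧ (toℕ y ≡ᵇ toℕ qy))
  ∧ (holds a (toℕ x) (toℕ qx) ∨ holds b (toℕ y) (toℕ qy))

-- Win j C : Algorithm, knowing that the target lies in C, can guarantee to
-- query (hit) the target within j further queries, whatever the Adversary
-- answers.
Win : {m n : ℕ} → ℕ → Cand m n → Set
Win {m} {n} zero    C = ∀ x y → C x y ≡ false
Win {m} {n} (suc j) C =
  Σ (Fin m) λ qx → Σ (Fin n) λ qy →
    ∀ (a b : Dir) → Win j (λ x y → C x y ∧ consistent qx qy a b x y)

-- j queries guarantee finding the target on the m × n grid.
-- qc(m, n) is the least such j, so  qc(m,n) ≤ B  iff  some j ≤ B is Solvable.
Solvable : ℕ → ℕ → ℕ → Set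
Solvable m n j = Win {m} {n} j (λ _ _ → true)

module Submission where

-- Cut the rows of a block of height 2h + 1 into h rows below a middle row c
-- and h rows above it.  Querying points (q , c) of the middle row performs a
-- binary search: an answer whose row part reads "y < c" holds for every target
-- under c, so it only tells that targets above c satisfy its column part, which
-- cuts the x-interval U of the upper half at q (symmetrically, "y > c" cuts the
-- interval L of the lower half).  Targets on row c lie in U ∩ L, which every
-- query halves; after ⌈log₂ (w + 1)⌉ queries U and L are disjoint subintervals
-- of the original interval of width w, so |U| + |L| ≤ w, and the two halves are
-- solved one after the other.  Hence blocks of height n = 2^k − 1 need at most
-- J k w queries, where J (k + 1) w = ⌈log₂ (w + 1)⌉ + max_{a + b ≤ w} (J k a + J k b),
-- and 2^(J k w) · 2^(k 2^k) ≤ 8^n (w + n)^n follows by induction on k, the step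
-- being AM–GM: 4 (a + h) (b + h) ≤ (w + 2h + 1)².

open import Defs
open import Data.Nat using (ℕ; _+_; _*_; _^_; _≤_)
open import Data.Product using (Σ; _×_)
open import Relation.Binary.PropositionalEquality using (_≡_)

open import Data.Bool using (true; false; T; _∧_; _∨_)
open import Data.Bool.Properties using (T-∧; T-∨)
open import Data.Empty using (⊥; ⊥-elim)
open import Data.Fin using (Fin; toℕ; fromℕ<; zero)
open import Data.Fin.Properties using (toℕ<n; toℕ-fromℕ<)
open import Data.Nat
open import Data.Nat.Properties
open import Algebra.Properties.CommutativeSemigroup +-commutativeSemigroup using () renaming (interchange to +-interchange)
open import Algebra.Properties.CommutativeSemigroup *-commutativeSemigroup using () renaming (interchange to *-interchange)
open import Data.Nat.Tactic.RingSolver using (solve-∀)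
open import Data.Product using (∃-syntax; _,_; proj₁; proj₂; map₁)
open import Data.Sum using (_⊎_; inj₁; inj₂; [_,_]′) renaming (map to map-⊎)
open import Data.Unit using (tt)
open import Function using (const; id; _∘_)
open import Function.Bundles using (Equivalence)
open import Relation.Binary.Definitions using (Decidable; tri<; tri≈; tri>)
open import Relation.Binary.PropositionalEquality
open import Relation.Nullary using (Dec; ¬_)
open import Relation.Nullary.Decidable using (yes; no; isYes; toWitness; fromWitness; _×-dec_; _→-dec_)

infix 4 _⊆_

_⊆_ : ∀ {m n} → Cand m n → Cand m n → Set
C ⊆ D = ∀ x y → T (C x y) → T (D x y)

_∪_ : ∀ {m n} → Cand m n → Cand m n → Cand m n
(C ∪ D) x y = C x y ∨ D x y

¬T⇒≡false : ∀ {b} → ¬ T b → b ≡ false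
¬T⇒≡false {false} _ = refl
¬T⇒≡false {true} ¬t = ⊥-elim (¬t tt)

T-∧-mapˡ : ∀ {c d} e → (T c → T d) → T (c ∧ e) → T (d ∧ e)
T-∧-mapˡ {c} e f t = Equivalence.from T-∧ (map₁ f (Equivalence.to (T-∧ {c} {e}) t))

T-∨-∧-weaken : ∀ c d e → T ((c ∨ d) ∧ e) → T ((c ∧ e) ∨ d)
T-∨-∧-weaken true  d     true  _ = tt
T-∨-∧-weaken false true  e     _ = tt

Win-mono : ∀ {m n} j {C D : Cand m n} → C ⊆ D → Win j D → Win j C
Win-mono zero    C⊆D none x y = ¬T⇒≡false λ t → subst T (none x y) (C⊆D x y t)
Win-mono (suc j) C⊆D (qx , qy , win) =
  qx , qy , λ a b → Win-mono j (λ x y → T-∧-mapˡ _ (C⊆D x y)) (win a b)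

Win-∪ : ∀ {m n} i j {C D : Cand m n} → Win i C → Win j D → Win (i + j) (C ∪ D)
Win-∪ zero j {C} {D} noneC winD =
  Win-mono j (λ x y → subst (λ c → T (c ∨ D x y) → T (D x y)) (sym (noneC x y)) id) winD
Win-∪ (suc i) j {C} {D} (qx , qy , win) winD =
  qx , qy , λ a b → Win-mono (i + j) (λ x y → T-∨-∧-weaken (C x y) (D x y) _) (Win-∪ i j (win a b) winD)

-- Spending surplus queries requires some point of the grid to ask about.
module _ {m n} (x₀ : Fin m) (y₀ : Fin n) where

  Win-∅ : ∀ j {C : Cand m n} → (∀ x y → C x y ≡ false) → Win j C
  Win-∅ zero    none = none
  Win-∅ (suc j) none = x₀ , y₀ , λ a b → Win-∅ j (λ x y → cong (_∧ _) (none x y))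

  Win-≤ : ∀ {i j} {C : Cand m n} → i ≤ j → Win i C → Win j C
  Win-≤ {j = j} z≤n none = Win-∅ j none
  Win-≤ (s≤s i≤j) (qx , qy , win) = qx , qy , λ a b → Win-≤ i≤j (win a b)

Holds : Dir → ℕ → ℕ → Set
Holds below t q = t < q
Holds above t q = q < t

holds-sound : ∀ d t q → T (holds d t q) → Holds d t q
holds-sound below t q = <ᵇ⇒< t q
holds-sound above t q = <ᵇ⇒< q t

consistent-sound : ∀ {m n} (qx : Fin m) (qy : Fin n) a b x y → T (consistent qx qy a b x y) →
  Holds a (toℕ x) (toℕ qx) ⊎ Holds b (toℕ y) (toℕ qy)
consistent-sound qx qy a b x y t =
  map-⊎ (holds-sound a _ _) (holds-sound b _ _) (Equivalence.to T-∨ (proj₂ (Equivalence.to T-∧ t)))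

Win-query : ∀ {m n j} {C : Cand m n} (D : Dir → Dir → Cand m n) {qx qy} (qx<m : qx < m) (qy<n : qy < n) →
  (∀ a b x y → T (C x y) → Holds a (toℕ x) qx ⊎ Holds b (toℕ y) qy → T (D a b x y)) →
  (∀ a b → Win j (D a b)) → Win (suc j) C
Win-query {j = j} {C} D {qx} {qy} qx<m qy<n narrow win = fromℕ< qx<m , fromℕ< qy<n , λ a b →
  Win-mono j (λ x y t → let c , k = Equivalence.to (T-∧ {C x y}) t in narrow a b x y c (answer a b x y k))
    (win a b)
  where
  answer : ∀ a b x y → T (consistent (fromℕ< qx<m) (fromℕ< qy<n) a b x y) →
    Holds a (toℕ x) qx ⊎ Holds b (toℕ y) qy
  answer a b x y k =
    map-⊎ (subst (Holds a (toℕ x)) (toℕ-fromℕ< qx<m)) (subst (Holds b (toℕ y)) (toℕ-fromℕ< qy<n))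
      (consistent-sound _ _ a b x y k)

cand : ∀ {m n} {P : ℕ → ℕ → Set} → Decidable P → Cand m n
cand P? x y = isYes (P? (toℕ x) (toℕ y))

cand-⊆ : ∀ {m n} {P Q : ℕ → ℕ → Set} {P? : Decidable P} {Q? : Decidable Q} →
  (∀ {x y} → P x y → Q x y) → cand {m} {n} P? ⊆ cand Q?
cand-⊆ P⇒Q x y t = fromWitness (P⇒Q (toWitness t))

cand-⊆-∪ : ∀ {m n} {P Q R : ℕ → ℕ → Set} {P? : Decidable P} {Q? : Decidable Q} {R? : Decidable R} →
  (∀ {x y} → P x y → Q x y ⊎ R x y) → cand {m} {n} P? ⊆ cand Q? ∪ cand R?
cand-⊆-∪ {Q? = Q?} {R? = R?} P⇒Q⊎R x y t =
  Equivalence.from (T-∨ {cand Q? x y}) (map-⊎ fromWitness fromWitness (P⇒Q⊎R (toWitness t)))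

Win-none : ∀ {m n} {P : ℕ → ℕ → Set} {P? : Decidable P} → (∀ {x y} → ¬ P x y) → Win {m} {n} 0 (cand P?)
Win-none ¬P x y = ¬T⇒≡false (λ t → ¬P (toWitness t))

record Interval : Set where
  constructor [_,_⟩
  field
    lo hi : ℕ
open Interval

infix 4 _∈ᵢ_ _∈ᵢ?_ _⊑_

_∈ᵢ_ : ℕ → Interval → Set
x ∈ᵢ I = lo I ≤ x × x < hi I

_∈ᵢ?_ : ∀ x I → Dec (x ∈ᵢ I)
x ∈ᵢ? I = lo I ≤? x ×-dec x <? hi I

width : Interval → ℕ
width I = hi I ∸ lo I

_⊑_ : Interval → Interval → Set
I ⊑ J = lo J ≤ lo I × hi I ≤ hi J

_∩_ : Interval → Interval → Interval
I ∩ J = [ lo I ⊔ lo J , hi I ⊓ hi J ⟩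

Disjoint : Interval → Interval → Set
Disjoint I J = ∀ {x} → x ∈ᵢ I → x ∈ᵢ J → ⊥

⊑-refl : ∀ {I} → I ⊑ I
⊑-refl = ≤-refl , ≤-refl

⊑-trans : ∀ {I J K} → I ⊑ J → J ⊑ K → I ⊑ K
⊑-trans (lo≤ , ≤hi) (lo≤′ , ≤hi′) = ≤-trans lo≤′ lo≤ , ≤-trans ≤hi ≤hi′

∈-⊑ : ∀ {x I J} → x ∈ᵢ I → I ⊑ J → x ∈ᵢ J
∈-⊑ (lo≤x , x<hi) (lo≤ , ≤hi) = ≤-trans lo≤ lo≤x , <-≤-trans x<hi ≤hi

∩-⊑ˡ : ∀ {I J} → I ∩ J ⊑ I
∩-⊑ˡ {I} {J} = m≤m⊔n (lo I) (lo J) , m⊓n≤m (hi I) (hi J)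

∈-∩ : ∀ {x I J} → x ∈ᵢ I → x ∈ᵢ J → x ∈ᵢ I ∩ J
∈-∩ (lo≤x , x<hi) (lo≤x′ , x<hi′) = ⊔-lub lo≤x lo≤x′ , ⊓-glb x<hi x<hi′

∩-empty⇒disjoint : ∀ {I J} → hi (I ∩ J) ≤ lo (I ∩ J) → Disjoint I J
∩-empty⇒disjoint empty x∈I x∈J =
  let lo≤x , x<hi = ∈-∩ x∈I x∈J in <-irrefl refl (<-≤-trans (≤-<-trans lo≤x x<hi) empty)

side-by-side : ∀ {I J B} → I ⊑ B → J ⊑ B → lo I ≤ hi I → hi I ≤ lo J → width I + width J ≤ width B
side-by-side {I} {J} {B} (B≤I , I≤B) (B≤J , J≤B) I-ordered I≤J = begin
  width I + width J             ≤⟨ +-mono-≤ (∸-monoʳ-≤ (hi I) B≤I) (∸-mono J≤B I≤J) ⟩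
  (hi I ∸ lo B) + (hi B ∸ hi I) ≡⟨ sym (+-∸-comm (hi B ∸ hi I) B≤hiI) ⟩
  (hi I + (hi B ∸ hi I)) ∸ lo B ≡⟨ cong (_∸ lo B) (m+[n∸m]≡n I≤B) ⟩
  width B                       ∎
  where
  open ≤-Reasoning
  B≤hiI : lo B ≤ hi I
  B≤hiI = ≤-trans B≤I I-ordered

disjoint-width : ∀ {I J B} → I ⊑ B → J ⊑ B → Disjoint I J → width I + width J ≤ width B
disjoint-width {I} {J} {B} I⊑B J⊑B disjoint with lo I <? hi I | lo J <? hi J
... | no I-empty | _ rewrite m≤n⇒m∸n≡0 (≮⇒≥ I-empty) = ∸-mono (proj₂ J⊑B) (proj₁ J⊑B)
... | yes _ | no J-empty rewrite m≤n⇒m∸n≡0 (≮⇒≥ J-empty) | +-identityʳ (width I) =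
  ∸-mono (proj₂ I⊑B) (proj₁ I⊑B)
... | yes I-ne | yes J-ne with hi I ≤? lo J | hi J ≤? lo I
...   | yes I≤J | _ = side-by-side I⊑B J⊑B (<⇒≤ I-ne) I≤J
...   | no _ | yes J≤I =
  subst (_≤ width B) (+-comm (width J) (width I)) (side-by-side J⊑B I⊑B (<⇒≤ J-ne) J≤I)
...   | no I≰J | no J≰I = ⊥-elim (disjoint (m≤m⊔n (lo I) (lo J) , ⊔-pres-<m I-ne (≰⇒> I≰J))
                                (m≤n⊔m (lo I) (lo J) , ⊔-pres-<m (≰⇒> J≰I) J-ne))

ShorterThan : ℕ → Interval → Set
ShorterThan P I = hi I < lo I + P

shorter-⊑ : ∀ {P I J} → I ⊑ J → ShorterThan P J → ShorterThan P I
shorter-⊑ {P} (lo≤ , ≤hi) J-short = <-≤-trans (≤-<-trans ≤hi J-short) (+-monoˡ-≤ P lo≤)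

width<⇒shorter : ∀ {P} I → width I < P → ShorterThan P I
width<⇒shorter I w<P = ≤-<-trans (m≤n+m∸n (hi I) (lo I)) (+-monoʳ-< (lo I) w<P)

shorter-1⇒hi≤lo : ∀ {I} → ShorterThan 1 I → hi I ≤ lo I
shorter-1⇒hi≤lo {I} short = ≤-pred (subst (hi I <_) (+-comm (lo I) 1) short)

cut : Dir → Interval → ℕ → Interval
cut below I q = [ lo I , q ⟩
cut above I q = [ suc q , hi I ⟩

cut-∈ : ∀ d {x q I} → x ∈ᵢ I → Holds d x q → x ∈ᵢ cut d I q
cut-∈ below (lo≤x , _) x<q = lo≤x , x<q
cut-∈ above (_ , x<hi) q<x = q<x , x<hi

cut-⊑ : ∀ d {q I B} → I ⊑ B → q ∈ᵢ B → cut d I q ⊑ B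
cut-⊑ below (lo≤ , _) (_ , q<hi) = lo≤ , <⇒≤ q<hi
cut-⊑ above (_ , ≤hi) (lo≤q , _) = m≤n⇒m≤1+n lo≤q , ≤hi

midpoint : Interval → ℕ
midpoint I = lo I + ⌊ width I /2⌋

midpoint-∈ : ∀ {I} → lo I < hi I → midpoint I ∈ᵢ I
midpoint-∈ {I} lo<hi = m≤m+n (lo I) _ , (begin-strict
  lo I + ⌊ width I /2⌋ <⟨ +-monoʳ-< (lo I) (half<width (width I) (m<n⇒0<n∸m lo<hi)) ⟩
  lo I + width I       ≡⟨ m+[n∸m]≡n (<⇒≤ lo<hi) ⟩
  hi I                 ∎)
  where
  open ≤-Reasoning
  half<width : ∀ w → 0 < w → ⌊ w /2⌋ < w
  half<width (suc w) _ = ⌊n/2⌋<n w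

width<2P : ∀ {P I} → lo I < hi I → ShorterThan (2 * P) I → width I < 2 * P
width<2P {P} {I} lo<hi short =
  +-cancelˡ-< (lo I) _ _ (subst (_< lo I + 2 * P) (sym (m+[n∸m]≡n (<⇒≤ lo<hi))) short)

halves< : ∀ {w P} → w < 2 * P → ⌊ w /2⌋ < P × ⌈ w /2⌉ ≤ P
halves< {w} {P} w<2P = ≤⌈P+P/2⌉ (⌊n/2⌋-mono (s≤s w<P+P)) , ≤⌈P+P/2⌉ (⌈n/2⌉-mono (<⇒≤ w<P+P))
  where
  w<P+P : w < P + P
  w<P+P = subst (w <_) (cong (P +_) (+-identityʳ P)) w<2P
  ≤⌈P+P/2⌉ : ∀ {v} → v ≤ ⌈ P + P /2⌉ → v ≤ P
  ≤⌈P+P/2⌉ {v} = subst (v ≤_) (sym (n≡⌈n+n/2⌉ P))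

cut-midpoint : ∀ d {P I} → lo I < hi I → ShorterThan (2 * P) I → ShorterThan P (cut d I (midpoint I))
cut-midpoint below {P} {I} lo<hi short = +-monoʳ-< (lo I) (proj₁ (halves< (width<2P {P} lo<hi short)))
cut-midpoint above {P} {I} lo<hi short = begin-strict
  hi I                                   ≡⟨ sym (m+[n∸m]≡n (<⇒≤ lo<hi)) ⟩
  lo I + width I                         ≡⟨ cong (lo I +_) (sym (⌊n/2⌋+⌈n/2⌉≡n (width I))) ⟩
  lo I + (⌊ width I /2⌋ + ⌈ width I /2⌉) ≡⟨ sym (+-assoc (lo I) _ _) ⟩
  midpoint I + ⌈ width I /2⌉             ≤⟨ +-monoʳ-≤ (midpoint I) (proj₂ (halves< w<2P)) ⟩
  midpoint I + P                         <⟨ n<1+n (midpoint I + P) ⟩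
  suc (midpoint I) + P                   ∎
  where
  open ≤-Reasoning
  w<2P : width I < 2 * P
  w<2P = width<2P {P} lo<hi short

record Split : Set where
  field
    upper lower : Interval
open Split

gap : Split → Interval
gap S = upper S ∩ lower S

Inside : Interval → Split → Set
Inside B S = upper S ⊑ B × lower S ⊑ B

Box : Interval → Interval → ℕ → ℕ → Set
Box I R x y = x ∈ᵢ I × y ∈ᵢ R

box? : ∀ I R → Decidable (Box I R)
box? I R x y = x ∈ᵢ? I ×-dec y ∈ᵢ? R

InSplit : Interval → ℕ → Split → ℕ → ℕ → Set
InSplit R c S x y = y ∈ᵢ R × (c ≤ y → x ∈ᵢ upper S) × (y ≤ c → x ∈ᵢ lower S)

split? : ∀ R c S → Decidable (InSplit R c S)
split? R c S x y = y ∈ᵢ? R ×-dec (c ≤? y →-dec x ∈ᵢ? upper S) ×-dec (y ≤? c →-dec x ∈ᵢ? lower S)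

next : Dir → Dir → ℕ → Split → Split
next a below q S = record S { upper = cut a (upper S) q }
next a above q S = record S { lower = cut a (lower S) q }

next-sound : ∀ a b {R c q S x y} → InSplit R c S x y → Holds a x q ⊎ Holds b y c →
  InSplit R c (next a b q S) x y
next-sound a below (y∈R , up , low) answer =
  y∈R , (λ c≤y → cut-∈ a (up c≤y) ([ id , (λ y<c → ⊥-elim (<⇒≱ y<c c≤y)) ]′ answer)) , low
next-sound a above (y∈R , up , low) answer =
  y∈R , up , (λ y≤c → cut-∈ a (low y≤c) ([ id , (λ c<y → ⊥-elim (<⇒≱ c<y y≤c)) ]′ answer))

gap-next : ∀ a b {q S} → gap (next a b q S) ⊑ cut a (gap S) q
gap-next below below {q} {S} = ≤-refl , m⊓n≤m q (hi (lower S))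
gap-next below above {q} {S} = ≤-refl , m⊓n≤n (hi (upper S)) q
gap-next above below {q} {S} = m≤m⊔n (suc q) (lo (lower S)) , ≤-refl
gap-next above above {q} {S} = m≤n⊔m (lo (upper S)) (suc q) , ≤-refl

next-inside : ∀ a b {q B S} → Inside B S → q ∈ᵢ B → Inside B (next a b q S)
next-inside a below (U⊑B , L⊑B) q∈B = cut-⊑ a U⊑B q∈B , L⊑B
next-inside a above (U⊑B , L⊑B) q∈B = U⊑B , cut-⊑ a L⊑B q∈B

gap-⊑ : ∀ {B S} → Inside B S → gap S ⊑ B
gap-⊑ (U⊑B , _) = ⊑-trans ∩-⊑ˡ U⊑B

split-halves : ∀ {y0 c h S x y} → Disjoint (upper S) (lower S) → InSplit [ y0 , suc c + h ⟩ c S x y →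
  Box (upper S) [ suc c , suc c + h ⟩ x y ⊎ Box (lower S) [ y0 , c ⟩ x y
split-halves {c = c} {y = y} disjoint (y∈R , up , low) with <-cmp y c
... | tri< y<c _ _  = inj₂ (low (<⇒≤ y<c) , proj₁ y∈R , y<c)
... | tri≈ _ refl _ = ⊥-elim (disjoint (up ≤-refl) (low ≤-refl))
... | tri> _ _ c<y  = inj₁ (up (<⇒≤ c<y) , c<y , proj₂ y∈R)

height : ℕ → ℕ
height zero    = 0
height (suc k) = suc (height k + height k)

2^k≡1+height : ∀ k → 2 ^ k ≡ suc (height k)
2^k≡1+height zero    = refl
2^k≡1+height (suc k) = begin
  2 * 2 ^ k                                 ≡⟨ cong (2 *_) (2^k≡1+height k) ⟩
  2 * suc (height k)                        ≡⟨ cong suc (+-suc (height k) (height k + 0)) ⟩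
  suc (suc (height k + (height k + 0)))     ≡⟨ cong (λ h → suc (suc (height k + h))) (+-identityʳ _) ⟩
  suc (height (suc k))                      ∎
  where open ≡-Reasoning

binary-length : ∀ w → ∃[ s ] w < 2 ^ s × 2 ^ s ≤ suc (2 * w)
binary-length zero = 0 , s≤s z≤n , s≤s z≤n
binary-length (suc w) with binary-length w
... | s , w<2^s , 2^s≤1+2w with m≤n⇒m<n∨m≡n w<2^s
...   | inj₁ 1+w<2^s = s , 1+w<2^s , ≤-trans 2^s≤1+2w (s≤s (*-monoʳ-≤ 2 (n≤1+n w)))
...   | inj₂ 1+w≡2^s = suc s ,
          subst (λ p → suc w < 2 * p) 1+w≡2^s (m<m+n (suc w) z<s) ,
          subst (λ p → 2 * p ≤ suc (2 * suc w)) 1+w≡2^s (n≤1+n (2 * suc w))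

bits : ℕ → ℕ
bits w = proj₁ (binary-length w)

maxUpTo : (ℕ → ℕ) → ℕ → ℕ
maxUpTo f zero    = f zero
maxUpTo f (suc n) = maxUpTo f n ⊔ f (suc n)

≤-maxUpTo : ∀ f {i n} → i ≤ n → f i ≤ maxUpTo f n
≤-maxUpTo f {n = zero}  z≤n = ≤-refl
≤-maxUpTo f {n = suc n} i≤1+n with m≤n⇒m<n∨m≡n i≤1+n
... | inj₁ i<1+n = ≤-trans (≤-maxUpTo f (≤-pred i<1+n)) (m≤m⊔n _ _)
... | inj₂ refl  = m≤n⊔m _ _

maxUpTo-attained : ∀ f n → ∃[ i ] i ≤ n × maxUpTo f n ≡ f i
maxUpTo-attained f zero = 0 , z≤n , refl
maxUpTo-attained f (suc n) with maxUpTo-attained f n | ⊔-sel (maxUpTo f n) (f (suc n))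
... | i , i≤n , max≡fi | inj₁ ⊔≡max = i , m≤n⇒m≤1+n i≤n , trans ⊔≡max max≡fi
... | _ | inj₂ ⊔≡f = suc n , ≤-refl , ⊔≡f

maxSplit : (ℕ → ℕ → ℕ) → ℕ → ℕ
maxSplit f w = maxUpTo (λ a → maxUpTo (f a) (w ∸ a)) w

≤-maxSplit : ∀ f {a b w} → a + b ≤ w → f a b ≤ maxSplit f w
≤-maxSplit f {a} {b} {w} a+b≤w = ≤-trans
  (≤-maxUpTo (f a) (subst (_≤ w ∸ a) (m+n∸m≡n a b) (∸-monoˡ-≤ a a+b≤w)))
  (≤-maxUpTo (λ a → maxUpTo (f a) (w ∸ a)) (≤-trans (m≤m+n a b) a+b≤w))

maxSplit-attained : ∀ f w → ∃[ a ] ∃[ b ] a + b ≤ w × maxSplit f w ≡ f a b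
maxSplit-attained f w with maxUpTo-attained (λ a → maxUpTo (f a) (w ∸ a)) w
... | a , a≤w , max≡ with maxUpTo-attained (f a) (w ∸ a)
...   | b , b≤w∸a , max≡′ =
  a , b , subst (a + b ≤_) (m+[n∸m]≡n a≤w) (+-monoʳ-≤ a b≤w∸a) , trans max≡ max≡′

budget : ℕ → ℕ → ℕ
budget zero    w = 0
budget (suc k) w = bits w + maxSplit (λ a b → budget k a + budget k b) w

module Strategy {m n} (x₀ : Fin m) (y₀ : Fin n) where

  module BinarySearch (B R : Interval) (c : ℕ) (B≤m : hi B ≤ m) (c<n : c < n) (M : ℕ)
    (finish : ∀ S → Inside B S → Disjoint (upper S) (lower S) → Win {m} {n} M (cand (split? R c S))) where

    search : ∀ s S → Inside B S → ShorterThan (2 ^ s) (gap S) → Win {m} {n} (s + M) (cand (split? R c S))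
    search zero S inside short = finish S inside (∩-empty⇒disjoint (shorter-1⇒hi≤lo short))
    search (suc s) S inside short with lo (gap S) <? hi (gap S)
    ... | no gap-empty =
      Win-≤ x₀ y₀ (m≤n+m M (suc s)) (finish S inside (∩-empty⇒disjoint (≮⇒≥ gap-empty)))
    ... | yes gap-nonempty =
      Win-query {C = cand (split? R c S)} (λ a b → cand (split? R c (next a b q S)))
        (<-≤-trans (proj₂ q∈B) B≤m) c<n
        (λ a b x y t answer → fromWitness (next-sound a b (toWitness t) answer))
        (λ a b → search s (next a b q S) (next-inside a b inside q∈B)
                   (shorter-⊑ (gap-next a b) (cut-midpoint a gap-nonempty short)))
      where
      q : ℕ
      q = midpoint (gap S)
      q∈B : q ∈ᵢ B
      q∈B = ∈-⊑ (midpoint-∈ gap-nonempty) (gap-⊑ inside)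

  main : ∀ k B y0 → hi B ≤ m → y0 + height k ≤ n →
    Win {m} {n} (budget k (width B)) (cand (box? B [ y0 , y0 + height k ⟩))
  main zero B y0 _ _ = Win-none {P? = box? B _} λ (_ , y0≤y , y<y0+0) →
    <-irrefl refl (<-≤-trans y<y0+0 (≤-trans (≤-reflexive (+-identityʳ y0)) y0≤y))
  main (suc k) B y0 B≤m rows≤n =
    Win-mono (bits (width B) + M) (cand-⊆ {P? = box? B _} {Q? = split? R c whole} box⇒split)
      (search (bits (width B)) whole (⊑-refl , ⊑-refl)
        (shorter-⊑ (∩-⊑ˡ {B} {B}) (width<⇒shorter B (proj₁ (proj₂ (binary-length (width B)))))))
    where
    h c : ℕ
    h = height k
    c = y0 + h
    R : Interval
    R = [ y0 , suc c + h ⟩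
    rows : y0 + height (suc k) ≡ suc c + h
    rows = trans (+-suc y0 (h + h)) (cong suc (sym (+-assoc y0 h h)))
    upper≤n : suc c + h ≤ n
    upper≤n = subst (_≤ n) rows rows≤n
    c<n : c < n
    c<n = ≤-trans (m≤m+n (suc c) h) upper≤n
    both : ℕ → ℕ → ℕ
    both a b = budget k a + budget k b
    M : ℕ
    M = maxSplit both (width B)
    whole : Split
    whole = record { upper = B ; lower = B }
    box⇒split : ∀ {x y} → Box B [ y0 , y0 + height (suc k) ⟩ x y → InSplit R c whole x y
    box⇒split {y = y} (x∈B , y0≤y , y<hi) = (y0≤y , subst (y <_) rows y<hi) , const x∈B , const x∈B
    halves : ∀ S → Inside B S →
      Win {m} {n} (both (width (upper S)) (width (lower S)))
        (cand (box? (upper S) [ suc c , suc c + h ⟩) ∪ cand (box? (lower S) [ y0 , c ⟩))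
    halves S (U⊑B , L⊑B) = Win-∪ (budget k (width (upper S))) (budget k (width (lower S)))
      (main k (upper S) (suc c) (≤-trans (proj₂ U⊑B) B≤m) upper≤n)
      (main k (lower S) y0 (≤-trans (proj₂ L⊑B) B≤m) (<⇒≤ c<n))
    finish : ∀ S → Inside B S → Disjoint (upper S) (lower S) → Win {m} {n} M (cand (split? R c S))
    finish S inside@(U⊑B , L⊑B) disjoint =
      Win-≤ x₀ y₀ (≤-maxSplit both (disjoint-width U⊑B L⊑B disjoint))
        (Win-mono (both (width (upper S)) (width (lower S)))
          (cand-⊆-∪ {P? = split? R c S} {Q? = box? (upper S) _} {R? = box? (lower S) _}
            (split-halves disjoint))
          (halves S inside))
    open BinarySearch B R c B≤m c<n M finish

[m*n]^o≡m^o*n^o : ∀ m n o → (m * n) ^ o ≡ m ^ o * n ^ o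
[m*n]^o≡m^o*n^o m n zero    = refl
[m*n]^o≡m^o*n^o m n (suc o) =
  trans (cong (m * n *_) ([m*n]^o≡m^o*n^o m n o)) (*-interchange m n (m ^ o) (n ^ o))

4xy≤[x+y]² : ∀ x y → 4 * (x * y) ≤ (x + y) * (x + y)
4xy≤[x+y]² x y = [ ordered , swap ∘ ordered ]′ (≤-total x y)
  where
  swap : 4 * (y * x) ≤ (y + x) * (y + x) → 4 * (x * y) ≤ (x + y) * (x + y)
  swap = subst₂ _≤_ (cong (4 *_) (*-comm y x)) (cong (λ s → s * s) (+-comm y x))
  square : ∀ x t → (x + (x + t)) * (x + (x + t)) ≡ 4 * (x * (x + t)) + t * t
  square = solve-∀
  ordered : ∀ {x y} → x ≤ y → 4 * (x * y) ≤ (x + y) * (x + y)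
  ordered {x} x≤y with t , refl ← m≤n⇒∃[o]m+o≡n x≤y =
    subst (4 * (x * (x + t)) ≤_) (sym (square x t)) (m≤m+n _ (t * t))

doubling-bound : ∀ h g e₁ e₂ {w₁ w₂ w} → w₁ + w₂ ≤ w → 2 ^ g ≤ suc (2 * w) →
  2 ^ e₁ ≤ 8 ^ h * (w₁ + h) ^ h → 2 ^ e₂ ≤ 8 ^ h * (w₂ + h) ^ h →
  2 ^ (g + e₁ + e₂ + 2 * suc h) ≤ 8 ^ suc (h + h) * (w + suc (h + h)) ^ suc (h + h)
doubling-bound h g e₁ e₂ {w₁} {w₂} {w} w₁+w₂≤w 2^g≤1+2w bound₁ bound₂ = begin
  2 ^ (g + e₁ + e₂ + 2 * suc h)
    ≡⟨ powers ⟩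
  2 ^ g * 2 ^ e₁ * 2 ^ e₂ * (4 * 4 ^ h)
    ≤⟨ *-monoˡ-≤ (4 * 4 ^ h) (*-mono-≤ (*-mono-≤ 2^g≤1+2w bound₁) bound₂) ⟩
  suc (2 * w) * (8 ^ h * X ^ h) * (8 ^ h * Y ^ h) * (4 * 4 ^ h)
    ≡⟨ regroup (suc (2 * w)) (8 ^ h) (X ^ h) (Y ^ h) (4 ^ h) ⟩
  4 * suc (2 * w) * (8 ^ h * 8 ^ h) * (4 ^ h * (X ^ h * Y ^ h))
    ≡⟨ cong (4 * suc (2 * w) * (8 ^ h * 8 ^ h) *_) (sym [4XY]^h) ⟩
  4 * suc (2 * w) * (8 ^ h * 8 ^ h) * (4 * (X * Y)) ^ h
    ≤⟨ *-mono-≤ (*-monoˡ-≤ (8 ^ h * 8 ^ h) 4[1+2w]≤8S) (^-monoˡ-≤ h 4XY≤S²) ⟩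
  8 * S * (8 ^ h * 8 ^ h) * (S * S) ^ h
    ≡⟨ collect ⟩
  8 ^ suc (h + h) * S ^ suc (h + h)
    ∎
  where
  open ≤-Reasoning
  X Y S : ℕ
  X = w₁ + h
  Y = w₂ + h
  S = w + suc (h + h)
  regroup : ∀ a p q r f → a * (p * q) * (p * r) * (4 * f) ≡ 4 * a * (p * p) * (f * (q * r))
  regroup = solve-∀
  powers : 2 ^ (g + e₁ + e₂ + 2 * suc h) ≡ 2 ^ g * 2 ^ e₁ * 2 ^ e₂ * (4 * 4 ^ h)
  powers = begin-equality
    2 ^ (g + e₁ + e₂ + 2 * suc h)
      ≡⟨ ^-distribˡ-+-* 2 (g + e₁ + e₂) (2 * suc h) ⟩
    2 ^ (g + e₁ + e₂) * 2 ^ (2 * suc h)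
      ≡⟨ cong (_* 2 ^ (2 * suc h)) (trans (^-distribˡ-+-* 2 (g + e₁) e₂) (cong (_* 2 ^ e₂) (^-distribˡ-+-* 2 g e₁))) ⟩
    2 ^ g * 2 ^ e₁ * 2 ^ e₂ * 2 ^ (2 * suc h)
      ≡⟨ cong (2 ^ g * 2 ^ e₁ * 2 ^ e₂ *_) (sym (^-*-assoc 2 2 (suc h))) ⟩
    2 ^ g * 2 ^ e₁ * 2 ^ e₂ * (4 * 4 ^ h)
      ∎
  [4XY]^h : (4 * (X * Y)) ^ h ≡ 4 ^ h * (X ^ h * Y ^ h)
  [4XY]^h = trans ([m*n]^o≡m^o*n^o 4 (X * Y) h) (cong (4 ^ h *_) ([m*n]^o≡m^o*n^o X Y h))
  4[1+2w]≤8S : 4 * suc (2 * w) ≤ 8 * S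
  4[1+2w]≤8S =
    ≤-trans (m≤m+n (4 * suc (2 * w)) 4) (≤-trans (≤-reflexive (eight w)) (*-monoʳ-≤ 8 (1+w≤S)))
    where
    eight : ∀ w → 4 * suc (2 * w) + 4 ≡ 8 * suc w
    eight = solve-∀
    1+w≤S : suc w ≤ S
    1+w≤S = subst (suc w ≤_) (sym (+-suc w (h + h))) (s≤s (m≤m+n w (h + h)))
  X+Y≤S : X + Y ≤ S
  X+Y≤S = begin
    (w₁ + h) + (w₂ + h) ≡⟨ +-interchange w₁ h w₂ h ⟩
    (w₁ + w₂) + (h + h) ≤⟨ +-monoˡ-≤ (h + h) w₁+w₂≤w ⟩
    w + (h + h)         ≤⟨ +-monoʳ-≤ w (n≤1+n (h + h)) ⟩
    S                   ∎
  4XY≤S² : 4 * (X * Y) ≤ S * S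
  4XY≤S² = ≤-trans (4xy≤[x+y]² X Y) (*-mono-≤ X+Y≤S X+Y≤S)
  collect : 8 * S * (8 ^ h * 8 ^ h) * (S * S) ^ h ≡ 8 ^ suc (h + h) * S ^ suc (h + h)
  collect = begin-equality
    8 * S * (8 ^ h * 8 ^ h) * (S * S) ^ h
      ≡⟨ cong (8 * S * (8 ^ h * 8 ^ h) *_) ([m*n]^o≡m^o*n^o S S h) ⟩
    8 * S * (8 ^ h * 8 ^ h) * (S ^ h * S ^ h)
      ≡⟨ shuffle 8 S (8 ^ h) (S ^ h) ⟩
    8 * (8 ^ h * 8 ^ h) * (S * (S ^ h * S ^ h))
      ≡⟨ sym (cong₂ (λ p q → 8 * p * (S * q)) (^-distribˡ-+-* 8 h h) (^-distribˡ-+-* S h h)) ⟩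
    8 ^ suc (h + h) * S ^ suc (h + h)
      ∎
    where
    shuffle : ∀ e s p q → e * s * (p * p) * (q * q) ≡ e * (p * p) * (s * (q * q))
    shuffle = solve-∀

budget-bound : ∀ k w → 2 ^ (budget k w + 2 ^ k * k) ≤ 8 ^ height k * (w + height k) ^ height k
budget-bound zero    w = ≤-refl
budget-bound (suc k) w with maxSplit-attained (λ a b → budget k a + budget k b) w
... | a , b , a+b≤w , max≡ =
  subst (λ e → 2 ^ e ≤ 8 ^ height (suc k) * (w + height (suc k)) ^ height (suc k)) (sym exponent)
    (doubling-bound (height k) (bits w) e₁ e₂ a+b≤w (proj₂ (proj₂ (binary-length w)))
      (budget-bound k a) (budget-bound k b))
  where
  e₁ e₂ : ℕ
  e₁ = budget k a + 2 ^ k * k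
  e₂ = budget k b + 2 ^ k * k
  regroup : ∀ g j₁ j₂ A k → g + (j₁ + j₂) + 2 * A * suc k ≡ g + (j₁ + A * k) + (j₂ + A * k) + 2 * A
  regroup = solve-∀
  exponent : budget (suc k) w + 2 ^ suc k * suc k ≡ bits w + e₁ + e₂ + 2 * suc (height k)
  exponent = begin
    bits w + maxSplit (λ a b → budget k a + budget k b) w + 2 * 2 ^ k * suc k
      ≡⟨ cong (λ M → bits w + M + 2 * 2 ^ k * suc k) max≡ ⟩
    bits w + (budget k a + budget k b) + 2 * 2 ^ k * suc k
      ≡⟨ regroup (bits w) (budget k a) (budget k b) (2 ^ k) k ⟩
    bits w + e₁ + e₂ + 2 * 2 ^ k
      ≡⟨ cong (λ A → bits w + e₁ + e₂ + 2 * A) (2^k≡1+height k) ⟩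
    bits w + e₁ + e₂ + 2 * suc (height k)
      ∎
    where open ≡-Reasoning

n+1≡2^k⇒height≡n : ∀ {n k} → n + 1 ≡ 2 ^ k → height k ≡ n
n+1≡2^k⇒height≡n {n} {k} n+1≡2^k =
  +-cancelʳ-≡ 1 (height k) n (trans (+-comm (height k) 1) (trans (sym (2^k≡1+height k)) (sym n+1≡2^k)))

grid-solvable : ∀ k {m} → 1 ≤ m → Solvable m (height k) (budget k m)
grid-solvable zero    _ = λ _ ()
grid-solvable (suc k) {suc m} (s≤s z≤n) =
  Win-mono (budget (suc k) (suc m)) (λ x y _ → fromWitness ((z≤n , toℕ<n x) , (z≤n , toℕ<n y)))
    (Strategy.main zero zero (suc k) [ 0 , suc m ⟩ 0 ≤-refl ≤-refl)

lemma9 : (m n k : ℕ) → 1 ≤ m → n + 1 ≡ 2 ^ k →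
    Σ ℕ λ j → Solvable m n j × (2 ^ (j + (n + 1) * k) ≤ 2 ^ (3 * n) * (m + n) ^ n)
lemma9 m n k 1≤m n+1≡2^k rewrite sym (n+1≡2^k⇒height≡n n+1≡2^k) =
  budget k m , grid-solvable k 1≤m , subst₂ _≤_ exponent powers (budget-bound k m)
  where
  exponent : 2 ^ (budget k m + 2 ^ k * k) ≡ 2 ^ (budget k m + (height k + 1) * k)
  exponent = cong (λ A → 2 ^ (budget k m + A * k)) (trans (2^k≡1+height k) (+-comm 1 (height k)))
  powers : 8 ^ height k * (m + height k) ^ height k ≡ 2 ^ (3 * height k) * (m + height k) ^ height k
  powers = cong (_* (m + height k) ^ height k) (^-*-assoc 2 3 (height k))
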